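{- Let $D$ be a strongly connected digraph with girth $g$, and let $T$ be a DFS tree of $D$ rooted at $r$, of length $t$, with generations $V_0,\ldots,V_t$. Let $k=\lceil \frac{t+1}{g-1}\rceil$ and, for each $h\in\{0,\ldots,k-1\}$, let $U_h=\bigcup_{j=0}^{g-2}V_{h(g-1)+j}$, where $V_m=\emptyset$ whenever $m>t$. Let $G$ be the undirected graph with vertex set $\{U_0,\ldots,U_{k-1}\}$ in which $U_iU_j$ is an edge whenever $i>j$ and there is a backward arc $(u,v)$ of $D$ with $u\in U_i$ and $v\in U_j$. Then $\chi_A(D)\leq\chi(G)$.
   Context: All digraphs are finite and loopless. Strongly connected: directed path between any ordered pair of distinct vertices. Girth: length of a shortest directed cycle. A DFS tree $T$ of $D$ rooted at $r$ is the spanning out-branching produced by depth-first search on $D$ from $r$. $v$ is a descendant of $u$ if there is a directed $uv$-path in $T$; an arc $(u,v)$ of $D$ is a backward arc (relative to $T$) if $u$ is a descendant of $v$. $P_u$ is the unique directed path in $T$ from $r$ to $u$, $l(P_u)$ its number of arcs; the length $t$ of $T$ is $\max_u l(P_u)$ and $V_i=\{u: l(P_u)=i\}$. $\chi_A(D)$ is the minimum number of colors in a vertex coloring of $D$ whose color classes induce no directed cycle. -}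

module Defs where

open import Data.Nat using (ℕ; zero; suc; _+_; _*_; _∸_; _≤_; _<_; _/_)
open import Data.Fin using (Fin)
import Data.Fin
open import Data.Fin.Subset using (Subset; _∈_; _∉_; ⁅_⁆; _∪_)
open import Data.Bool using (Bool; true; false)
open import Data.List using (List; []; _∷_; _++_)
open import Data.Product using (Σ; _×_; _,_; ∃)
open import Data.Sum using (_⊎_)
open import Relation.Binary.PropositionalEquality using (_≡_; _≢_)
open import Relation.Binary.Construct.Closure.ReflexiveTransitive using (Star)
open import Relation.Nullary using (¬_)
import Data.List.Membership.Propositional as ListMem

record Digraph : Set where
  field
    n        : ℕ
    adj      : Fin n → Fin n → Bool
    loopless : ∀ v → adj v v ≡ false

open Digraph public

Arc : (D : Digraph) → Fin (n D) → Fin (n D) → Set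
Arc D u v = adj D u v ≡ true

-- Strongly connected: a directed path (equivalently walk) between
-- any ordered pair of distinct vertices.
StronglyConnected : Digraph → Set
StronglyConnected D = ∀ u v → u ≢ v → Star (Arc D) u v

IsCycle : (D : Digraph) → (m : ℕ) → (ℕ → Fin (n D)) → Set
IsCycle D m w =
  (1 ≤ m) ×
  (w m ≡ w 0) ×
  (∀ i → i < m → Arc D (w i) (w (suc i))) ×
  (∀ i j → i < m → j < m → w i ≡ w j → i ≡ j)

HasCycleOfLength : (D : Digraph) → ℕ → Set
HasCycleOfLength D m = Σ (ℕ → Fin (n D)) (IsCycle D m)

IsGirth : Digraph → ℕ → Set
IsGirth D g = HasCycleOfLength D g × (∀ m → HasCycleOfLength D m → g ≤ m)

IsAcyclicColoring : (D : Digraph) → (q : ℕ) → (Fin (n D) → Fin q) → Set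
IsAcyclicColoring D q c =
  ∀ m w → IsCycle D m w → ¬ (∀ i → i < m → c (w i) ≡ c (w 0))

IsDichromaticNumber : Digraph → ℕ → Set
IsDichromaticNumber D a =
  Σ (Fin (n D) → Fin a) (IsAcyclicColoring D a) ×
  (∀ q → (c : Fin (n D) → Fin q) → IsAcyclicColoring D q c → a ≤ q)

-- Depth-first search (nondeterministic choice of the next neighbour)

Arcs : ℕ → Set
Arcs N = List (Fin N × Fin N)

-- Explore D u S A S' : the loop "while u has an out-neighbour v not yet
-- visited: add tree arc (u,v), visit v recursively", started with visited
-- set S, produces the tree arcs A (in order) and final visited set S'.
data Explore (D : Digraph) : Fin (n D) → Subset (n D) → Arcs (n D) → Subset (n D) → Set where
  done : ∀ {u S} → (∀ v → Arc D u v → v ∈ S) → Explore D u S [] S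
  step : ∀ {u v S A₁ S₁ A₂ S₂} →
         Arc D u v → v ∉ S →
         Explore D v (S ∪ ⁅ v ⁆) A₁ S₁ →
         Explore D u S₁ A₂ S₂ →
         Explore D u S ((u , v) ∷ (A₁ ++ A₂)) S₂

IsDFSTree : (D : Digraph) → Fin (n D) → Arcs (n D) → Set
IsDFSTree D r A = ∃ λ S → Explore D r ⁅ r ⁆ A S

TreeArc : ∀ {N} → Arcs N → Fin N → Fin N → Set
TreeArc A u v = ListMem._∈_ (u , v) A

data TPath {N} (A : Arcs N) : Fin N → Fin N → ℕ → Set where
  here  : ∀ {u} → TPath A u u 0
  there : ∀ {u w v i} → TreeArc A u w → TPath A w v i → TPath A u v (suc i)

Descendant : ∀ {N} → Arcs N → Fin N → Fin N → Set
Descendant A u v = ∃ λ i → TPath A u v i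

BackwardArc : (D : Digraph) → Arcs (n D) → Fin (n D) → Fin (n D) → Set
BackwardArc D A u v = Arc D u v × Descendant A v u

-- l(P_u) = i, i.e. u ∈ V_i
InGen : ∀ {N} → Arcs N → Fin N → ℕ → Fin N → Set
InGen A r i u = TPath A r u i

IsTreeLength : ∀ {N} → Arcs N → Fin N → ℕ → Set
IsTreeLength {N} A r t =
  (∃ λ (u : Fin N) → InGen A r t u) × (∀ u i → InGen A r i u → i ≤ t)

-- ceiling division ⌈ a / b ⌉ (b > 0; value 0 for b = 0, never used)
⌈_/_⌉ : ℕ → ℕ → ℕ
⌈ a / zero ⌉  = 0
⌈ a / suc b ⌉ = (a + b) / suc b

InU : ∀ {N} → Arcs N → Fin N → (g h : ℕ) → Fin N → Set
InU A r g h u = Σ ℕ λ j → (j ≤ g ∸ 2) × InGen A r (h * (g ∸ 1) + j) u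

BackBetween : (D : Digraph) → Arcs (n D) → Fin (n D) → ℕ → ℕ → ℕ → Set
BackBetween D A r g i j =
  Σ (Fin (n D)) λ u → Σ (Fin (n D)) λ v →
    BackwardArc D A u v × InU A r g i u × InU A r g j v

GEdge : (D : Digraph) → Arcs (n D) → Fin (n D) → ℕ → (k : ℕ) → Fin k → Fin k → Set
GEdge D A r g k i j =
  (Data.Fin.toℕ j < Data.Fin.toℕ i × BackBetween D A r g (Data.Fin.toℕ i) (Data.Fin.toℕ j)) ⊎
  (Data.Fin.toℕ i < Data.Fin.toℕ j × BackBetween D A r g (Data.Fin.toℕ j) (Data.Fin.toℕ i))

IsProperColoring : ∀ {k} → (Fin k → Fin k → Set) → (q : ℕ) → (Fin k → Fin q) → Set
IsProperColoring E q f = ∀ i j → E i j → f i ≢ f j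

IsChromaticNumber : ∀ {k} → (Fin k → Fin k → Set) → ℕ → Set
IsChromaticNumber {k} E b =
  Σ (Fin k → Fin b) (IsProperColoring E b) ×
  (∀ q → (f : Fin k → Fin q) → IsProperColoring E q f → b ≤ q)

module Submission where

-- Depth-first search from r visits every vertex, and in post-order every arc that is not
-- backward goes from a vertex to one finished earlier, so every directed cycle contains a
-- backward arc (y, z). Together with the tree path from z to y it closes a cycle, so that path
-- spans at least g − 1 generations: z lies in a strictly lower block U_h than y, and U_h U_h′
-- is an edge of G. Colouring each vertex by the G-colour of its block is therefore acyclic.

open import Defs
open import Data.Nat using (ℕ; zero; suc; _+_; _*_; _∸_; _≤_; _<_; _/_; _%_; z≤n; s≤s)
open import Data.Nat.Properties hiding (_≟_)
open import Data.Nat.DivMod using (m≡m%n+[m/n]*n; m%n<n; m/n≡1+[m∸n]/n; /-monoˡ-≤)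
open import Data.Fin using (Fin; toℕ; fromℕ<)
open import Data.Fin.Properties using (_≟_; toℕ-fromℕ<)
open import Data.Fin.Subset using (Subset; _∈_; _∉_; _⊆_; ⁅_⁆; _∪_)
open import Data.Fin.Subset.Properties using (_∈?_; x∈⁅x⁆; x∈⁅y⁆⇒x≡y; x≢y⇒x∉⁅y⁆; p⊆p∪q; q⊆p∪q; x∈p∪q⁻)
open import Data.List using (_∷_; _++_)
open import Data.List.Membership.Propositional.Properties using (∈-++⁺ˡ; ∈-++⁺ʳ; ∈-++⁻)
open import Data.List.Relation.Unary.Any using (here; there)
open import Data.Product using (∃; _×_; _,_; proj₁; proj₂)
open import Data.Sum using (_⊎_; inj₁; inj₂; [_,_]′)
open import Data.Empty using (⊥-elim)
open import Function using (_∘_; const)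
open import Relation.Nullary using (¬_; yes; no)
open import Relation.Binary.PropositionalEquality
open import Relation.Binary.Construct.Closure.ReflexiveTransitive using (Star; ε; _◅_)

select : ∀ {N} {B : Set} → Subset N → (Fin N → B) → (Fin N → B) → Fin N → B
select P f g x with x ∈? P
... | yes _ = f x
... | no _  = g x

select-∈ : ∀ {N} {B : Set} (P : Subset N) (f g : Fin N → B) {x} → x ∈ P → select P f g x ≡ f x
select-∈ P f g {x} x∈P with x ∈? P
... | yes _   = refl
... | no x∉P = ⊥-elim (x∉P x∈P)

select-∉ : ∀ {N} {B : Set} (P : Subset N) (f g : Fin N → B) {x} → x ∉ P → select P f g x ≡ g x
select-∉ P f g {x} x∉P with x ∈? P
... | yes x∈P = ⊥-elim (x∉P x∈P)
... | no _    = refl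

module _ {N : ℕ} where

  tpath-mono : {A A′ : Arcs N} → (∀ {p q} → TreeArc A p q → TreeArc A′ p q) →
               ∀ {u v i} → TPath A u v i → TPath A′ u v i
  tpath-mono A⊆A′ here         = here
  tpath-mono A⊆A′ (there uw P) = there (A⊆A′ uw) (tpath-mono A⊆A′ P)

  descendant-mono : {A A′ : Arcs N} → (∀ {p q} → TreeArc A p q → TreeArc A′ p q) →
                    ∀ {u v} → Descendant A u v → Descendant A′ u v
  descendant-mono A⊆A′ (i , P) = i , tpath-mono A⊆A′ P

  x∉p∪⁅y⁆ : ∀ {S : Subset N} {v y} → y ∉ S → y ≢ v → y ∉ S ∪ ⁅ v ⁆
  x∉p∪⁅y⁆ {S} {v} y∉S y≢v y∈ = [ y∉S , y≢v ∘ x∈⁅y⁆⇒x≡y v ]′ (x∈p∪q⁻ S ⁅ v ⁆ y∈)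

  x∈p∪⁅x⁆ : ∀ (S : Subset N) v → v ∈ S ∪ ⁅ v ⁆
  x∈p∪⁅x⁆ S v = q⊆p∪q S ⁅ v ⁆ (x∈⁅x⁆ v)

  -- The status of y in a step of the loop that explores v: visited before it (S), v itself,
  -- visited by the call at v (S₁ is the visited set after that call), or not yet visited.
  data Position (S S₁ : Subset N) (v : Fin N) : Fin N → Set where
    old   : ∀ {y} → y ∈ S → Position S S₁ v y
    pivot : Position S S₁ v v
    inner : ∀ {y} → y ≢ v → y ∉ S → y ∈ S₁ → Position S S₁ v y
    later : ∀ {y} → y ≢ v → y ∉ S₁ → Position S S₁ v y

  position : ∀ S S₁ v y → Position S S₁ v y
  position S S₁ v y with y ≟ v | y ∈? S | y ∈? S₁
  ... | yes refl | _       | _        = pivot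
  ... | no _     | yes y∈S | _        = old y∈S
  ... | no y≢v   | no y∉S  | yes y∈S₁ = inner y≢v y∉S y∈S₁
  ... | no y≢v   | no _    | no y∉S₁  = later y≢v y∉S₁

  tpath-vertex : {A : Arcs N} → ∀ {p q i} → TPath A p q i → ℕ → Fin N
  tpath-vertex {p = p} here         _       = p
  tpath-vertex {p = p} (there _ P) zero    = p
  tpath-vertex         (there _ P) (suc k) = tpath-vertex P k

  tpath-vertex-start : {A : Arcs N} → ∀ {p q i} (P : TPath A p q i) → tpath-vertex P 0 ≡ p
  tpath-vertex-start here        = refl
  tpath-vertex-start (there _ _) = refl

  tpath-vertex-end : {A : Arcs N} → ∀ {p q i} (P : TPath A p q i) → tpath-vertex P i ≡ q
  tpath-vertex-end here        = refl
  tpath-vertex-end (there _ P) = tpath-vertex-end P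

  tpath-vertex-treeArc : {A : Arcs N} → ∀ {p q i} (P : TPath A p q i) → ∀ {k} → k < i →
                         TreeArc A (tpath-vertex P k) (tpath-vertex P (suc k))
  tpath-vertex-treeArc (there pw P) {zero}  _         = subst (TreeArc _ _) (sym (tpath-vertex-start P)) pw
  tpath-vertex-treeArc (there _ P)  {suc k} (s≤s k<i) = tpath-vertex-treeArc P k<i

module Exploration {D : Digraph} where

  private
    N = n D

  treeArc-step₁ : ∀ {u v p q} {A₁ A₂ : Arcs N} → TreeArc A₁ p q → TreeArc ((u , v) ∷ A₁ ++ A₂) p q
  treeArc-step₁ = there ∘ ∈-++⁺ˡ

  treeArc-step₂ : ∀ {u v p q} {A₁ A₂ : Arcs N} → TreeArc A₂ p q → TreeArc ((u , v) ∷ A₁ ++ A₂) p q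
  treeArc-step₂ {A₁ = A₁} = there ∘ ∈-++⁺ʳ A₁

  explore-⊆ : ∀ {u S A S′} → Explore D u S A S′ → S ⊆ S′
  explore-⊆ (done _) x∈S = x∈S
  explore-⊆ (step {v = v} _ _ e₁ e₂) x∈S = explore-⊆ e₂ (explore-⊆ e₁ (p⊆p∪q ⁅ v ⁆ x∈S))

  explore-saturated : ∀ {u S A S′ z} → Explore D u S A S′ → Arc D u z → z ∈ S′
  explore-saturated (done sat)       uz = sat _ uz
  explore-saturated (step _ _ _ e₂) uz = explore-saturated e₂ uz

  explore-closed : ∀ {u S A S′ y z} → Explore D u S A S′ → y ∈ S′ → y ∉ S → Arc D y z → z ∈ S′
  explore-closed (done _) y∈S′ y∉S yz = ⊥-elim (y∉S y∈S′)
  explore-closed {y = y} (step {v = v} {S = S} {S₁ = S₁} _ _ e₁ e₂) y∈S₂ y∉S yz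
    with position S S₁ v y
  ... | old y∈S             = ⊥-elim (y∉S y∈S)
  ... | pivot               = explore-⊆ e₂ (explore-saturated e₁ yz)
  ... | inner y≢v _ y∈S₁    = explore-⊆ e₂ (explore-closed e₁ y∈S₁ (x∉p∪⁅y⁆ y∉S y≢v) yz)
  ... | later _ y∉S₁        = explore-closed e₂ y∈S₂ y∉S₁ yz

  explore-descendant : ∀ {u S A S′ y} → Explore D u S A S′ → y ∈ S′ → y ∉ S → Descendant A u y
  explore-descendant (done _) y∈S′ y∉S = ⊥-elim (y∉S y∈S′)
  explore-descendant {y = y} (step {v = v} {S = S} {S₁ = S₁} _ _ e₁ e₂) y∈S₂ y∉S
    with position S S₁ v y
  ... | old y∈S          = ⊥-elim (y∉S y∈S)
  ... | pivot            = 1 , there (here refl) here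
  ... | inner y≢v _ y∈S₁ with explore-descendant e₁ y∈S₁ (x∉p∪⁅y⁆ y∉S y≢v)
  ...   | i , P          = suc i , there (here refl) (tpath-mono treeArc-step₁ P)
  explore-descendant (step _ _ e₁ e₂) y∈S₂ y∉S
      | later _ y∉S₁     = descendant-mono treeArc-step₂ (explore-descendant e₂ y∈S₂ y∉S₁)

  explore-treeArc : ∀ {u S A S′ p q} → Explore D u S A S′ → TreeArc A p q → Arc D p q
  explore-treeArc (step uv _ _ _) (here refl) = uv
  explore-treeArc (step {A₁ = A₁} _ _ e₁ e₂) (there pq) =
    [ explore-treeArc e₁ , explore-treeArc e₂ ]′ (∈-++⁻ A₁ pq)

  explore-treeArc-visited : ∀ {u S A S′ p q} → Explore D u S A S′ → u ∈ S → TreeArc A p q →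
                            p ∈ S′ × q ∈ S′
  explore-treeArc-visited (step {v = v} {S = S} _ _ e₁ e₂) u∈S (here refl) =
    explore-⊆ e₂ (explore-⊆ e₁ (p⊆p∪q ⁅ v ⁆ u∈S)) , explore-⊆ e₂ (explore-⊆ e₁ (x∈p∪⁅x⁆ S v))
  explore-treeArc-visited (step {v = v} {S = S} {A₁ = A₁} _ _ e₁ e₂) u∈S (there pq)
    with ∈-++⁻ A₁ pq
  ... | inj₁ pq₁ with explore-treeArc-visited e₁ (x∈p∪⁅x⁆ S v) pq₁
  ...   | p∈S₁ , q∈S₁ = explore-⊆ e₂ p∈S₁ , explore-⊆ e₂ q∈S₁
  explore-treeArc-visited (step {v = v} _ _ e₁ e₂) u∈S (there pq)
      | inj₂ pq₂ = explore-treeArc-visited e₂ (explore-⊆ e₁ (p⊆p∪q ⁅ v ⁆ u∈S)) pq₂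

  record Levels (S : Subset N) (A : Arcs N) (lev₀ : Fin N → ℕ) : Set where
    field
      lev         : Fin N → ℕ
      lev-agrees  : ∀ {x} → x ∈ S → lev x ≡ lev₀ x
      lev-treeArc : ∀ {p q} → TreeArc A p q → lev q ≡ suc (lev p)

  explore-levels : ∀ {u S A S′} → Explore D u S A S′ → u ∈ S → ∀ lev₀ → Levels S A lev₀
  explore-levels (done _) _ lev₀ =
    record { lev = lev₀ ; lev-agrees = λ _ → refl ; lev-treeArc = λ () }
  explore-levels {u} (step {v = v} {S = S} {A₁ = A₁} _ v∉S e₁ e₂) u∈S lev₀ =
    record { lev = L₂.lev ; lev-agrees = agrees ; lev-treeArc = treeArc }
    where
      open ≡-Reasoning
      lev₀′ : Fin N → ℕ
      lev₀′ = select ⁅ v ⁆ (const (suc (lev₀ u))) lev₀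
      module L₁ = Levels (explore-levels e₁ (x∈p∪⁅x⁆ S v) lev₀′)
      module L₂ = Levels (explore-levels e₂ (explore-⊆ e₁ (p⊆p∪q ⁅ v ⁆ u∈S)) L₁.lev)

      agrees : ∀ {x} → x ∈ S → L₂.lev x ≡ lev₀ x
      agrees {x} x∈S = begin
        L₂.lev x  ≡⟨ L₂.lev-agrees (explore-⊆ e₁ (p⊆p∪q ⁅ v ⁆ x∈S)) ⟩
        L₁.lev x  ≡⟨ L₁.lev-agrees (p⊆p∪q ⁅ v ⁆ x∈S) ⟩
        lev₀′ x   ≡⟨ select-∉ ⁅ v ⁆ _ lev₀ (x≢y⇒x∉⁅y⁆ λ { refl → v∉S x∈S }) ⟩
        lev₀ x    ∎

      treeArc : ∀ {p q} → TreeArc ((u , v) ∷ A₁ ++ _) p q → L₂.lev q ≡ suc (L₂.lev p)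
      treeArc (here refl) = begin
        L₂.lev v        ≡⟨ L₂.lev-agrees (explore-⊆ e₁ (x∈p∪⁅x⁆ S v)) ⟩
        L₁.lev v        ≡⟨ L₁.lev-agrees (x∈p∪⁅x⁆ S v) ⟩
        lev₀′ v         ≡⟨ select-∈ ⁅ v ⁆ _ lev₀ (x∈⁅x⁆ v) ⟩
        suc (lev₀ u)    ≡⟨ cong suc (agrees u∈S) ⟨
        suc (L₂.lev u)  ∎
      treeArc {p} {q} (there pq) with ∈-++⁻ A₁ pq
      ... | inj₂ pq₂ = L₂.lev-treeArc pq₂
      ... | inj₁ pq₁ with explore-treeArc-visited e₁ (x∈p∪⁅x⁆ S v) pq₁
      ...   | p∈S₁ , q∈S₁ = begin
        L₂.lev q        ≡⟨ L₂.lev-agrees q∈S₁ ⟩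
        L₁.lev q        ≡⟨ L₁.lev-treeArc pq₁ ⟩
        suc (L₁.lev p)  ≡⟨ cong suc (L₂.lev-agrees p∈S₁) ⟨
        suc (L₂.lev p)  ∎

  record FinishingTimes (S : Subset N) (A : Arcs N) (S′ : Subset N) (c c′ : ℕ) : Set where
    field
      finish       : Fin N → ℕ
      counter-mono : c ≤ c′
      finish-range : ∀ {y} → y ∈ S′ → y ∉ S → c ≤ finish y × finish y < c′
      finish-arc   : ∀ {y z} → y ∈ S′ → y ∉ S → Arc D y z →
                     z ∈ S ⊎ Descendant A z y ⊎ finish z < finish y

  module FinishStep {u v S A₁ S₁ A₂ S₂} (v∉S : v ∉ S)
         (e₁ : Explore D v (S ∪ ⁅ v ⁆) A₁ S₁) (e₂ : Explore D u S₁ A₂ S₂) {c c₁ c₂}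
         (T₁ : FinishingTimes (S ∪ ⁅ v ⁆) A₁ S₁ c c₁) (T₂ : FinishingTimes S₁ A₂ S₂ (suc c₁) c₂) where

    private
      module T₁ = FinishingTimes T₁
      module T₂ = FinishingTimes T₂
      A = (u , v) ∷ A₁ ++ A₂

    finish : Fin N → ℕ
    finish = select ⁅ v ⁆ (const c₁) (select S₁ T₁.finish T₂.finish)

    finish-pivot : finish v ≡ c₁
    finish-pivot = select-∈ ⁅ v ⁆ _ _ (x∈⁅x⁆ v)

    finish-inner : ∀ {y} → y ≢ v → y ∈ S₁ → finish y ≡ T₁.finish y
    finish-inner y≢v y∈S₁ =
      trans (select-∉ ⁅ v ⁆ _ _ (x≢y⇒x∉⁅y⁆ y≢v)) (select-∈ S₁ _ _ y∈S₁)

    finish-later : ∀ {y} → y ≢ v → y ∉ S₁ → finish y ≡ T₂.finish y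
    finish-later y≢v y∉S₁ =
      trans (select-∉ ⁅ v ⁆ _ _ (x≢y⇒x∉⁅y⁆ y≢v)) (select-∉ S₁ _ _ y∉S₁)

    inner-range : ∀ {y} → y ≢ v → y ∉ S → y ∈ S₁ → c ≤ finish y × finish y < c₁
    inner-range y≢v y∉S y∈S₁ rewrite finish-inner y≢v y∈S₁ =
      T₁.finish-range y∈S₁ (x∉p∪⁅y⁆ y∉S y≢v)

    later-range : ∀ {y} → y ∈ S₂ → y ≢ v → y ∉ S₁ → c₁ < finish y × finish y < c₂
    later-range y∈S₂ y≢v y∉S₁ rewrite finish-later y≢v y∉S₁ = T₂.finish-range y∈S₂ y∉S₁

    range : ∀ {y} → y ∈ S₂ → y ∉ S → c ≤ finish y × finish y < c₂
    range {y} y∈S₂ y∉S with position S S₁ v y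
    ... | old y∈S = ⊥-elim (y∉S y∈S)
    ... | pivot rewrite finish-pivot = T₁.counter-mono , T₂.counter-mono
    ... | inner y≢v _ y∈S₁ with inner-range y≢v y∉S y∈S₁
    ...   | c≤ , <c₁ = c≤ , <-≤-trans <c₁ (≤-trans (n≤1+n _) T₂.counter-mono)
    range y∈S₂ y∉S | later y≢v y∉S₁ with later-range y∈S₂ y≢v y∉S₁
    ...   | c₁< , <c₂ = ≤-trans T₁.counter-mono (<⇒≤ c₁<) , <c₂

    arc : ∀ {y z} → y ∈ S₂ → y ∉ S → Arc D y z → z ∈ S ⊎ Descendant A z y ⊎ finish z < finish y
    arc {y} {z} y∈S₂ y∉S yz with position S S₁ v y | position S S₁ v z
    ... | old y∈S | _       = ⊥-elim (y∉S y∈S)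
    ... | _       | old z∈S = inj₁ z∈S
    ... | pivot   | pivot   = inj₂ (inj₁ (0 , here))
    ... | pivot   | inner z≢v z∉S z∈S₁ =
      inj₂ (inj₂ (<-≤-trans (proj₂ (inner-range z≢v z∉S z∈S₁)) (≤-reflexive (sym finish-pivot))))
    ... | pivot   | later _ z∉S₁ = ⊥-elim (z∉S₁ (explore-saturated e₁ yz))
    ... | inner y≢v _ y∈S₁ | pivot =
      inj₂ (inj₁ (descendant-mono treeArc-step₁ (explore-descendant e₁ y∈S₁ (x∉p∪⁅y⁆ y∉S y≢v))))
    ... | inner y≢v _ y∈S₁ | later _ z∉S₁ =
      ⊥-elim (z∉S₁ (explore-closed e₁ y∈S₁ (x∉p∪⁅y⁆ y∉S y≢v) yz))
    ... | inner y≢v _ y∈S₁ | inner z≢v z∉S z∈S₁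
      with T₁.finish-arc y∈S₁ (x∉p∪⁅y⁆ y∉S y≢v) yz
    ...   | inj₁ z∈S∪v        = ⊥-elim (x∉p∪⁅y⁆ z∉S z≢v z∈S∪v)
    ...   | inj₂ (inj₁ z↝y)   = inj₂ (inj₁ (descendant-mono treeArc-step₁ z↝y))
    ...   | inj₂ (inj₂ z<y)   rewrite finish-inner y≢v y∈S₁ | finish-inner z≢v z∈S₁ =
      inj₂ (inj₂ z<y)
    arc y∈S₂ y∉S yz | later y≢v y∉S₁ | pivot =
      inj₂ (inj₂ (≤-<-trans (≤-reflexive finish-pivot) (proj₁ (later-range y∈S₂ y≢v y∉S₁))))
    arc y∈S₂ y∉S yz | later y≢v y∉S₁ | inner z≢v z∉S z∈S₁ =
      inj₂ (inj₂ (<-trans (proj₂ (inner-range z≢v z∉S z∈S₁)) (proj₁ (later-range y∈S₂ y≢v y∉S₁))))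
    arc y∈S₂ y∉S yz | later y≢v y∉S₁ | later z≢v z∉S₁ with T₂.finish-arc y∈S₂ y∉S₁ yz
    ...   | inj₁ z∈S₁       = ⊥-elim (z∉S₁ z∈S₁)
    ...   | inj₂ (inj₁ z↝y) = inj₂ (inj₁ (descendant-mono treeArc-step₂ z↝y))
    ...   | inj₂ (inj₂ z<y) rewrite finish-later y≢v y∉S₁ | finish-later z≢v z∉S₁ =
      inj₂ (inj₂ z<y)

    times : FinishingTimes S A S₂ c c₂
    times = record
      { finish       = finish
      ; counter-mono = ≤-trans T₁.counter-mono (≤-trans (n≤1+n _) T₂.counter-mono)
      ; finish-range = range
      ; finish-arc   = arc
      }

  explore-finishingTimes : ∀ {u S A S′} → Explore D u S A S′ → ∀ c → ∃ (FinishingTimes S A S′ c)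
  explore-finishingTimes (done _) c = c , record
    { finish       = const c
    ; counter-mono = ≤-refl
    ; finish-range = λ y∈S y∉S → ⊥-elim (y∉S y∈S)
    ; finish-arc   = λ y∈S y∉S _ → ⊥-elim (y∉S y∈S)
    }
  explore-finishingTimes (step _ v∉S e₁ e₂) c
    with explore-finishingTimes e₁ c
  ... | c₁ , T₁ with explore-finishingTimes e₂ (suc c₁)
  ...   | c₂ , T₂ = c₂ , FinishStep.times v∉S e₁ e₂ T₁ T₂

bounded-search : ∀ {P Q : ℕ → Set} m → (∀ i → i < m → P i ⊎ Q i) →
                 (∃ λ i → i < m × P i) ⊎ (∀ i → i < m → Q i)
bounded-search zero    _     = inj₂ λ _ ()
bounded-search {P} {Q} (suc m) P⊎Q with P⊎Q 0 (s≤s z≤n)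
... | inj₁ p₀ = inj₁ (0 , s≤s z≤n , p₀)
... | inj₂ q₀ with bounded-search {P ∘ suc} {Q ∘ suc} m (λ i i<m → P⊎Q (suc i) (s≤s i<m))
...   | inj₁ (i , i<m , p) = inj₁ (suc i , s≤s i<m , p)
...   | inj₂ qs = inj₂ λ { zero _ → q₀ ; (suc i) (s≤s i<m) → qs i i<m }

closedWalk-not-descending : ∀ {X : Set} (φ : X → ℕ) (w : ℕ → X) {m} → 1 ≤ m → w m ≡ w 0 →
                            ¬ (∀ i → i < m → φ (w (suc i)) < φ (w i))
closedWalk-not-descending φ w {suc m} _ closed descending =
  m+n≮n m (φ (w 0)) (subst (λ x → suc m + φ x ≤ φ (w 0)) closed (descent (suc m) ≤-refl))
  where
    descent : ∀ i → i ≤ suc m → i + φ (w i) ≤ φ (w 0)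
    descent zero    _   = ≤-refl
    descent (suc i) i<m = ≤-trans (+-monoʳ-< i (descending i i<m)) (descent i (<⇒≤ i<m))

[m+n]/n≡1+m/n : ∀ m d → (m + suc d) / suc d ≡ suc (m / suc d)
[m+n]/n≡1+m/n m d =
  trans (m/n≡1+[m∸n]/n (m≤n+m (suc d) m)) (cong (λ x → suc (x / suc d)) (m+n∸n≡m m (suc d)))

m/n<[m+o]/n : ∀ {d j} m → suc d ≤ j → m / suc d < (m + j) / suc d
m/n<[m+o]/n {d} {j} m d<j = begin-strict
  m / suc d              <⟨ n<1+n _ ⟩
  suc (m / suc d)        ≡⟨ [m+n]/n≡1+m/n m d ⟨
  (m + suc d) / suc d    ≤⟨ /-monoˡ-≤ (suc d) (+-monoʳ-≤ m d<j) ⟩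
  (m + j) / suc d        ∎
  where open ≤-Reasoning

m≤n⇒m/o<⌈[n+1]/o⌉ : ∀ {m t} d → m ≤ t → m / suc d < ⌈ t + 1 / suc d ⌉
m≤n⇒m/o<⌈[n+1]/o⌉ {m} {t} d m≤t = begin-strict
  m / suc d              ≤⟨ /-monoˡ-≤ (suc d) m≤t ⟩
  t / suc d              <⟨ n<1+n _ ⟩
  suc (t / suc d)        ≡⟨ trans (cong (_/ suc d) (+-assoc t 1 d)) ([m+n]/n≡1+m/n t d) ⟨
  (t + 1 + d) / suc d    ∎
  where open ≤-Reasoning

module DFSTree {D : Digraph} (strong : StronglyConnected D) {r : Fin (n D)} {A : Arcs (n D)}
               {S : Subset (n D)} (dfs : Explore D r ⁅ r ⁆ A S) where

  open Exploration

  private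
    N = n D

  visited-closed : ∀ {y z} → y ∈ S → Arc D y z → z ∈ S
  visited-closed {y} y∈S yz with y ≟ r
  ... | yes refl = explore-saturated dfs yz
  ... | no y≢r   = explore-closed dfs y∈S (x≢y⇒x∉⁅y⁆ y≢r) yz

  visited-reachable : ∀ {y x} → y ∈ S → Star (Arc D) y x → x ∈ S
  visited-reachable y∈S ε          = y∈S
  visited-reachable y∈S (yz ◅ z↝x) = visited-reachable (visited-closed y∈S yz) z↝x

  all-visited : ∀ x → x ∈ S
  all-visited x with x ≟ r
  ... | yes refl = explore-⊆ dfs (x∈⁅x⁆ r)
  ... | no x≢r   = visited-reachable (explore-⊆ dfs (x∈⁅x⁆ r)) (strong r x (x≢r ∘ sym))

  root-ancestor : ∀ x → Descendant A r x
  root-ancestor x with x ≟ r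
  ... | yes refl = 0 , here
  ... | no x≢r   = explore-descendant dfs (all-visited x) (x≢y⇒x∉⁅y⁆ x≢r)

  open Levels (explore-levels dfs (x∈⁅x⁆ r) (const 0)) using (lev; lev-agrees; lev-treeArc)

  lev-tpath-vertex : ∀ {p q i} (P : TPath A p q i) → ∀ {k} → k ≤ i → lev (tpath-vertex P k) ≡ lev p + k
  lev-tpath-vertex here         {zero} _ = sym (+-identityʳ _)
  lev-tpath-vertex (there _ _)  {zero} _ = sym (+-identityʳ _)
  lev-tpath-vertex {p} (there pw P) {suc k} (s≤s k≤i) = begin
    lev (tpath-vertex P k)  ≡⟨ lev-tpath-vertex P k≤i ⟩
    lev _ + k               ≡⟨ cong (_+ k) (lev-treeArc pw) ⟩
    suc (lev p) + k         ≡⟨ +-suc (lev p) k ⟨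
    lev p + suc k           ∎
    where open ≡-Reasoning

  lev-tpath : ∀ {p q i} → TPath A p q i → lev q ≡ lev p + i
  lev-tpath P = trans (cong lev (sym (tpath-vertex-end P))) (lev-tpath-vertex P ≤-refl)

  lev-root : lev r ≡ 0
  lev-root = lev-agrees (x∈⁅x⁆ r)

  inGen-lev : ∀ x → InGen A r (lev x) x
  inGen-lev x with root-ancestor x
  ... | i , P = subst (λ j → InGen A r j x) (sym (trans (lev-tpath P) (cong (_+ i) lev-root))) P

  private
    finishing = explore-finishingTimes dfs 0
    module F = FinishingTimes (proj₂ finishing)

  -- The root finishes last.
  rank : Fin N → ℕ
  rank = select ⁅ r ⁆ (const (proj₁ finishing)) F.finish

  rank-root : rank r ≡ proj₁ finishing
  rank-root = select-∈ ⁅ r ⁆ _ _ (x∈⁅x⁆ r)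

  rank-nonroot : ∀ {x} → x ≢ r → rank x ≡ F.finish x
  rank-nonroot x≢r = select-∉ ⁅ r ⁆ _ _ (x≢y⇒x∉⁅y⁆ x≢r)

  arc-backward-or-descending : ∀ {y z} → Arc D y z → Descendant A z y ⊎ rank z < rank y
  arc-backward-or-descending {y} {z} yz with y ≟ r | z ≟ r
  ... | _        | yes refl = inj₁ (root-ancestor y)
  ... | yes refl | no z≢r rewrite rank-root | rank-nonroot z≢r =
    inj₂ (proj₂ (F.finish-range (all-visited z) (x≢y⇒x∉⁅y⁆ z≢r)))
  ... | no y≢r   | no z≢r with F.finish-arc (all-visited y) (x≢y⇒x∉⁅y⁆ y≢r) yz
  ...   | inj₁ z∈⁅r⁆      = ⊥-elim (z≢r (x∈⁅y⁆⇒x≡y r z∈⁅r⁆))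
  ...   | inj₂ (inj₁ z↝y) = inj₁ z↝y
  ...   | inj₂ (inj₂ z<y) rewrite rank-nonroot y≢r | rank-nonroot z≢r = inj₂ z<y

  cycle-backwardArc : ∀ {m w} → IsCycle D m w → ∃ λ i → i < m × BackwardArc D A (w i) (w (suc i))
  cycle-backwardArc {m} {w} (1≤m , closed , arcs , _)
    with bounded-search m (λ i i<m → arc-backward-or-descending (arcs i i<m))
  ... | inj₁ (i , i<m , back) = i , i<m , arcs i i<m , back
  ... | inj₂ descending       = ⊥-elim (closedWalk-not-descending rank w 1≤m closed descending)

  backwardArc-cycle : ∀ {y z j} → Arc D y z → TPath A z y j → HasCycleOfLength D (suc j)
  backwardArc-cycle {y} {z} {j} yz P = w , s≤s z≤n , tpath-vertex-end P , arcs , injective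
    where
      w : ℕ → Fin N
      w zero    = y
      w (suc k) = tpath-vertex P k

      height : ℕ → ℕ
      height zero    = j
      height (suc k) = k

      lev-w : ∀ {k} → k < suc j → lev (w k) ≡ lev z + height k
      lev-w {zero}  _         = lev-tpath P
      lev-w {suc k} (s≤s k<j) = lev-tpath-vertex P (<⇒≤ k<j)

      height-injective : ∀ {k l} → k < suc j → l < suc j → height k ≡ height l → k ≡ l
      height-injective {zero}  {zero}  _         _         _   = refl
      height-injective {zero}  {suc l} _         (s≤s l<j) j≡l = ⊥-elim (<-irrefl (sym j≡l) l<j)
      height-injective {suc k} {zero}  (s≤s k<j) _         k≡j = ⊥-elim (<-irrefl k≡j k<j)
      height-injective {suc k} {suc l} _         _         k≡l = cong suc k≡l

      arcs : ∀ k → k < suc j → Arc D (w k) (w (suc k))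
      arcs zero    _         = subst (Arc D y) (sym (tpath-vertex-start P)) yz
      arcs (suc k) (s≤s k<j) = explore-treeArc dfs (tpath-vertex-treeArc P k<j)

      injective : ∀ k l → k < suc j → l < suc j → w k ≡ w l → k ≡ l
      injective k l k<j l<j wk≡wl = height-injective k<j l<j (+-cancelˡ-≡ (lev z) _ _
        (trans (sym (lev-w k<j)) (trans (cong lev wk≡wl) (lev-w l<j))))

  -- Blocks of d + 1 consecutive generations, for girth d + 2.
  module Blocks (d : ℕ) (girth : ∀ m → HasCycleOfLength D m → suc (suc d) ≤ m)
                {t : ℕ} (depth : ∀ u i → InGen A r i u → i ≤ t)
                {b : ℕ} {f : Fin ⌈ t + 1 / suc d ⌉ → Fin b}
                (proper : IsProperColoring (GEdge D A r (suc (suc d)) ⌈ t + 1 / suc d ⌉) b f) where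

    block : Fin N → Fin ⌈ t + 1 / suc d ⌉
    block x = fromℕ< (m≤n⇒m/o<⌈[n+1]/o⌉ d (depth x (lev x) (inGen-lev x)))

    toℕ-block : ∀ x → toℕ (block x) ≡ lev x / suc d
    toℕ-block x = toℕ-fromℕ< _

    inU-block : ∀ x → InU A r (suc (suc d)) (toℕ (block x)) x
    inU-block x rewrite toℕ-block x =
      lev x % suc d , <⇒≤pred (m%n<n (lev x) (suc d)) ,
      subst (λ i → InGen A r i x)
            (trans (m≡m%n+[m/n]*n (lev x) (suc d)) (+-comm (lev x % suc d) _)) (inGen-lev x)

    -- A tree path spanning fewer than d + 1 generations would close a cycle shorter than the girth.
    backwardArc-block< : ∀ {y z} → BackwardArc D A y z → toℕ (block z) < toℕ (block y)
    backwardArc-block< {y} {z} (yz , j , P) rewrite toℕ-block y | toℕ-block z | lev-tpath P =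
      m/n<[m+o]/n (lev z) (≤-pred (girth (suc j) (backwardArc-cycle yz P)))

    backwardArc-colours : ∀ {y z} → BackwardArc D A y z → f (block y) ≢ f (block z)
    backwardArc-colours {y} {z} back =
      proper (block y) (block z) (inj₁ (backwardArc-block< back , y , z , back , inU-block y , inU-block z))

    block-colouring-acyclic : IsAcyclicColoring D b (f ∘ block)
    block-colouring-acyclic m w cycle@(_ , closed , _) monochromatic
      with cycle-backwardArc cycle
    ... | i , i<m , back = backwardArc-colours back (trans (monochromatic i i<m) (sym next))
      where
        next : f (block (w (suc i))) ≡ f (block (w 0))
        next with m≤n⇒m<n∨m≡n i<m
        ... | inj₁ i+1<m = monochromatic (suc i) i+1<m
        ... | inj₂ refl  = cong (f ∘ block) closed

cycle-length≥2 : ∀ {D m} → HasCycleOfLength D m → 2 ≤ m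
cycle-length≥2 {m = zero} (_ , () , _)
cycle-length≥2 {D} {m = suc zero} (w , _ , closed , arcs , _)
  with trans (sym (subst (Arc D (w 0)) closed (arcs 0 (s≤s z≤n)))) (loopless D (w 0))
... | ()
cycle-length≥2 {m = suc (suc m)} _ = s≤s (s≤s z≤n)

proposition5 : (D : Digraph) → StronglyConnected D →
    (g : ℕ) → IsGirth D g →
    (r : Fin (n D)) → (A : Arcs (n D)) → IsDFSTree D r A →
    (t : ℕ) → IsTreeLength A r t →
    (a b : ℕ) → IsDichromaticNumber D a →
    IsChromaticNumber (GEdge D A r g ⌈ t + 1 / g ∸ 1 ⌉) b →
    a ≤ b
proposition5 D strong g (cycle , shortest) r A (S , dfs) t (_ , depth) a b (_ , minimal) ((f , proper) , _)
  with cycle-length≥2 {D} cycle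
... | s≤s (s≤s {n = d} _) = minimal b (f ∘ block) block-colouring-acyclic
  where
    open DFSTree strong dfs
    open Blocks d shortest depth proper
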